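{- Let $n,k,\ell,\gamma$ be non-negative integers. Then $$\left\{ {n \atop k} \right\}_{\ge \ell}=\sum_{i=0}^{n}(-1)^{i}\gamma^{i}\binom{n}{i}\left\{ {n-i \atop k} \right\}^{>\ell-1}_{\gamma}.$$
   Context: $\left\{ {n \atop k} \right\}_{\ge \ell}$ (associated Stirling number of the second kind) is the number of partitions of $\{1,\dots,n\}$ into $k$ non-empty blocks each containing at least $\ell$ elements. For integers $m,k\ge0$, $s$ and $\gamma\ge 0$, $\left\{ {m \atop k} \right\}^{>s}_{\gamma}$ is the sum, over all pairs $(G,P)$ where $G\subseteq\{1,\dots,m\}$ is possibly empty and $P$ is a set partition of $\{1,\dots,m\}\setminus G$ into exactly $k$ non-empty blocks each having more than $s$ elements, of the weight $\gamma^{|G|}$ (with $0^0=1$). Equivalently, it counts partitions of $\{1,\dots,m\}$ into $k$ non-empty blocks of size greater than $s$ together with a possibly empty special cell each of whose elements is placed in one of $\gamma$ compartments. -}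

module Defs where

open import Data.Nat as ℕ using (ℕ; zero; suc; _≡ᵇ_; _<ᵇ_; _≤ᵇ_)
open import Data.Fin using (Fin; toℕ)
open import Data.Fin.Properties using (_≟_)
open import Data.Maybe using (Maybe; just; nothing)
open import Data.Bool using (Bool; true; false; if_then_else_; _∧_)
open import Data.List using (List; []; _∷_; map; concatMap; allFin; upTo)
open import Data.Nat.ListAction using (sum)

allL : {A : Set} → (A → Bool) → List A → Bool
allL p []       = true
allL p (x ∷ xs) = p x ∧ allL p xs
open import Data.Integer as ℤ using (ℤ; +_)
open import Data.Integer.Properties as ℤP using ()
open import Relation.Nullary using (does)

words : {A : Set} → List A → ℕ → List (List A)
words xs zero    = [] ∷ []
words xs (suc m) = concatMap (λ w → map (_∷ w) xs) (words xs m)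

-- A set partition of {1,…,n} into k non-empty blocks is encoded (bijectively)
-- by its restricted growth word: the block labels 0,…,k-1 first occur in
-- increasing order, and every label occurs.  Elements labelled 'nothing'
-- (the special cell G) are skipped.
-- rg k c w : scanning w, c = number of distinct labels seen so far.
rg : (k : ℕ) → ℕ → List (Maybe (Fin k)) → Bool
rg k c []              = c ≡ᵇ k
rg k c (nothing ∷ w)   = rg k c w
rg k c (just j ∷ w)    =
  if toℕ j <ᵇ c then rg k c w
  else if toℕ j ≡ᵇ c then rg k (suc c) w
  else false

countM : {k : ℕ} → Maybe (Fin k) → List (Maybe (Fin k)) → ℕ
countM x []       = 0
countM x (y ∷ w)  = (if eqM x y then 1 else 0) ℕ.+ countM x w
  where
  eqM : {k : ℕ} → Maybe (Fin k) → Maybe (Fin k) → Bool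
  eqM nothing  nothing  = true
  eqM (just a) (just b) = does (a ≟ b)
  eqM _        _        = false

blocksAtLeast : (k ℓ : ℕ) → List (Maybe (Fin k)) → Bool
blocksAtLeast k ℓ w = allL (λ j → ℓ ≤ᵇ countM (just j) w) (allFin k)

blocksAbove : (k : ℕ) → ℤ → List (Maybe (Fin k)) → Bool
blocksAbove k s w = allL (λ j → does (s ℤP.<? (+ countM (just j) w))) (allFin k)

stirlingGE : (n k ℓ : ℕ) → ℕ
stirlingGE n k ℓ =
  sum (map (λ w → if rg k 0 w ∧ blocksAtLeast k ℓ w then 1 else 0)
           (words (map just (allFin k)) n))

-- {m k}^{>s}_γ : sum over pairs (G,P), G ⊆ {1..m} (entries labelled nothing),
-- P a partition of the rest into exactly k non-empty blocks of size > s,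
-- of the weight γ^|G|.
stirlingGamma : (m k : ℕ) → ℤ → (γ : ℕ) → ℕ
stirlingGamma m k s γ =
  sum (map (λ w → if rg k 0 w ∧ blocksAbove k s w
                  then γ ℕ.^ countM nothing w else 0)
           (words (nothing ∷ map just (allFin k)) m))

sumℤ : ℕ → (ℕ → ℤ) → ℤ
sumℤ n f = Data.List.foldr ℤ._+_ (+ 0) (map f (upTo (suc n)))

-- Deleting the special-cell letters (nothing) from a marked word leaves a plain
-- word, and the partition conditions survive the deletion; so for any weight h
-- on plain words, Φ_h m = Σ_w γ^(#cells w) h (erase w) over marked words of
-- length m equals Σ_j C(m,j) γ^(m−j) Ψ_h j, where Ψ_h j = Σ_u h u over plain
-- words of length j.  The theorem is the inverse relation
-- Ψ_h m = Σ_i C(m,i) (−γ)^i Φ_h (m − i), proved by induction on m for all h at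
-- once: summing out the first letter gives Ψ_h (m+1) = Ψ_Dh m and
-- Φ_h (m+1) = γ Φ_h m + Φ_Dh m for the head sum Dh of h, and Pascal's rule
-- turns these two recursions into each other.
{-# OPTIONS --safe #-}
module Submission where

open import Defs
open import Data.Nat as ℕ using (ℕ; zero; suc; _∸_; _≤ᵇ_; z≤n; s≤s⁻¹)
open import Data.Nat.Properties using (_≤?_; n<1+n; +-∸-assoc)
open import Data.Nat.Combinatorics using (_C_; nCk+nC[k+1]≡[n+1]C[k+1]; k>n⇒nCk≡0)
import Data.Nat.ListAction as ℕ
open import Data.Integer using (ℤ; +_; -_; _+_; _*_; _^_; _-_; _<_; +<+; -<+)
open import Data.Integer.Properties
  using (_<?_; +-identityˡ; +-assoc; *-assoc; *-zeroʳ; *-identityʳ; *-distribˡ-+; *-distribʳ-+;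
         pos-+; pos-*; drop‿+<+; +-0-commutativeMonoid; +-*-semiring)
open import Data.Integer.Tactic.RingSolver using (solve-∀)
open import Data.Fin using (toℕ)
open import Data.Fin.Properties using (toℕ<n; toℕ-inject₁; toℕ-fromℕ)
open import Data.Maybe using (Maybe; just; nothing)
open import Data.Bool using (Bool; true; false; if_then_else_; _∧_)
open import Data.List using (List; []; _∷_; _++_; map; foldr; concatMap; allFin; upTo; applyUpTo)
open import Data.List.Properties using (map-cong; map-∘; map-++)
open import Function using (_∘_; id; _⇔_; mk⇔)
open import Relation.Nullary.Decidable using (does-⇔)
open import Relation.Binary.PropositionalEquality
  using (_≡_; refl; sym; trans; cong; cong₂; module ≡-Reasoning)
open import Algebra.Properties.CommutativeMonoid.Sum +-0-commutativeMonoid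
  using (sum-cong-≗; ∑-distrib-+; sum-init-last) renaming (sum to ∑)
open import Algebra.Properties.Semiring.Sum +-*-semiring using (*-distribˡ-sum)

open ≡-Reasoning

sumBelow : ℕ → (ℕ → ℤ) → ℤ
sumBelow n f = ∑ {n} (f ∘ toℕ)

sumℤ≡sumBelow : ∀ n (f : ℕ → ℤ) → sumℤ n f ≡ sumBelow (suc n) f
sumℤ≡sumBelow n f = foldr-map-applyUpTo f id (suc n)
  where
  foldr-map-applyUpTo : ∀ (f : ℕ → ℤ) g m →
    foldr _+_ (+ 0) (map f (applyUpTo g m)) ≡ sumBelow m (f ∘ g)
  foldr-map-applyUpTo f g zero    = refl
  foldr-map-applyUpTo f g (suc m) = cong (_+_ (f (g 0))) (foldr-map-applyUpTo f (g ∘ suc) m)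

sumℤ-cong : ∀ n {f g : ℕ → ℤ} → (∀ i → f i ≡ g i) → sumℤ n f ≡ sumℤ n g
sumℤ-cong n f≗g = cong (foldr _+_ (+ 0)) (map-cong f≗g (upTo (suc n)))

sumBelow-cong : ∀ n {f g : ℕ → ℤ} → (∀ i → f i ≡ g i) → sumBelow n f ≡ sumBelow n g
sumBelow-cong n f≗g = sum-cong-≗ {n} (f≗g ∘ toℕ)

sumBelow-cong< : ∀ n {f g : ℕ → ℤ} → (∀ {i} → i ℕ.< n → f i ≡ g i) → sumBelow n f ≡ sumBelow n g
sumBelow-cong< n f≡g = sum-cong-≗ {n} (λ i → f≡g (toℕ<n i))

sumBelow-+ : ∀ n (f g : ℕ → ℤ) → sumBelow n (λ i → f i + g i) ≡ sumBelow n f + sumBelow n g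
sumBelow-+ n f g = ∑-distrib-+ {n} (f ∘ toℕ) (g ∘ toℕ)

sumBelow-*ˡ : ∀ n c (f : ℕ → ℤ) → sumBelow n (λ i → c * f i) ≡ c * sumBelow n f
sumBelow-*ˡ n c f = sym (*-distribˡ-sum {n} c (f ∘ toℕ))

sumBelow-snoc : ∀ n (f : ℕ → ℤ) → sumBelow (suc n) f ≡ sumBelow n f + f n
sumBelow-snoc n f = trans (sum-init-last {n} (f ∘ toℕ))
  (cong₂ _+_ (sum-cong-≗ {n} (cong f ∘ toℕ-inject₁)) (cong f (toℕ-fromℕ n)))

sumBelow-pascal : ∀ m (F : ℕ → ℤ) →
  sumBelow (suc (suc m)) (λ i → + (suc m C i) * F i) ≡
  sumBelow (suc m) (λ i → + (m C i) * F i) + sumBelow (suc m) (λ i → + (m C i) * F (suc i))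
sumBelow-pascal m F = begin
  F₀ + sumBelow (suc m) (λ i → + (suc m C suc i) * F (suc i))
    ≡⟨ cong (_+_ F₀) (sumBelow-cong (suc m) pascal) ⟩
  F₀ + sumBelow (suc m) (λ i → + (m C i) * F (suc i) + G i)
    ≡⟨ cong (_+_ F₀) (sumBelow-+ (suc m) (λ i → + (m C i) * F (suc i)) G) ⟩
  F₀ + (B + sumBelow (suc m) G)
    ≡⟨ cong (λ x → F₀ + (B + x)) (sumBelow-snoc m G) ⟩
  F₀ + (B + (sumBelow m G + G m))
    ≡⟨ cong (λ x → F₀ + (B + (sumBelow m G + x))) G-last≡0 ⟩
  F₀ + (B + (sumBelow m G + + 0))
    ≡⟨ rearrange F₀ B (sumBelow m G) ⟩
  F₀ + sumBelow m G + B ∎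
  where
  F₀ : ℤ
  F₀ = + 1 * F 0
  G : ℕ → ℤ
  G i = + (m C suc i) * F (suc i)
  B : ℤ
  B = sumBelow (suc m) (λ i → + (m C i) * F (suc i))
  pascal : ∀ i → + (suc m C suc i) * F (suc i) ≡ + (m C i) * F (suc i) + G i
  pascal i = begin
    + (suc m C suc i) * F (suc i)
      ≡⟨ cong (λ c → + c * F (suc i)) (sym (nCk+nC[k+1]≡[n+1]C[k+1] m i)) ⟩
    + (m C i ℕ.+ m C suc i) * F (suc i)
      ≡⟨ cong (_* F (suc i)) (pos-+ (m C i) (m C suc i)) ⟩
    (+ (m C i) + + (m C suc i)) * F (suc i)
      ≡⟨ *-distribʳ-+ (F (suc i)) (+ (m C i)) (+ (m C suc i)) ⟩
    + (m C i) * F (suc i) + G i ∎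
  G-last≡0 : G m ≡ + 0
  G-last≡0 = cong (λ c → + c * F (suc m)) (k>n⇒nCk≡0 (n<1+n m))
  rearrange : ∀ a b c → a + (b + (c + + 0)) ≡ a + c + b
  rearrange = solve-∀

binomialTerm : ℤ → (ℕ → ℤ) → ℕ → ℕ → ℤ
binomialTerm s a m i = + (m C i) * (s ^ i * a (m ∸ i))

binomialTransform : ℤ → (ℕ → ℤ) → ℕ → ℤ
binomialTransform s a m = sumBelow (suc m) (binomialTerm s a m)

binomialTransform-cong : ∀ s {a b : ℕ → ℤ} m → (∀ j → a j ≡ b j) →
  binomialTransform s a m ≡ binomialTransform s b m
binomialTransform-cong s m a≗b = sumBelow-cong (suc m) (λ i → cong (λ x → + (m C i) * (s ^ i * x)) (a≗b (m ∸ i)))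

binomialTransform-linear : ∀ s c (a b : ℕ → ℤ) m →
  binomialTransform s (λ j → a j + c * b j) m ≡ binomialTransform s a m + c * binomialTransform s b m
binomialTransform-linear s c a b m = begin
  binomialTransform s (λ j → a j + c * b j) m
    ≡⟨ sumBelow-cong (suc m) (λ i → distrib c (+ (m C i)) (s ^ i) (a (m ∸ i)) (b (m ∸ i))) ⟩
  sumBelow (suc m) (λ i → binomialTerm s a m i + c * binomialTerm s b m i)
    ≡⟨ sumBelow-+ (suc m) (binomialTerm s a m) (λ i → c * binomialTerm s b m i) ⟩
  binomialTransform s a m + sumBelow (suc m) (λ i → c * binomialTerm s b m i)
    ≡⟨ cong (_+_ (binomialTransform s a m)) (sumBelow-*ˡ (suc m) c (binomialTerm s b m)) ⟩
  binomialTransform s a m + c * binomialTransform s b m ∎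
  where
  distrib : ∀ c n p x y → n * (p * (x + c * y)) ≡ n * (p * x) + c * (n * (p * y))
  distrib = solve-∀

binomialTransform-suc : ∀ s (a : ℕ → ℤ) m →
  binomialTransform s a (suc m) ≡ binomialTransform s (a ∘ suc) m + s * binomialTransform s a m
binomialTransform-suc s a m = begin
  binomialTransform s a (suc m)
    ≡⟨ sumBelow-pascal m (λ i → s ^ i * a (suc m ∸ i)) ⟩
  sumBelow (suc m) (λ i → + (m C i) * (s ^ i * a (suc m ∸ i))) +
  sumBelow (suc m) (λ i → + (m C i) * (s * s ^ i * a (m ∸ i)))
    ≡⟨ cong₂ _+_ (sumBelow-cong< (suc m) (λ {i} i≤m → cong (λ j → + (m C i) * (s ^ i * a j)) (+-∸-assoc 1 (s≤s⁻¹ i≤m))))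
                 (sumBelow-cong (suc m) (λ i → pull-s s (+ (m C i)) (s ^ i) (a (m ∸ i)))) ⟩
  binomialTransform s (a ∘ suc) m + sumBelow (suc m) (λ i → s * binomialTerm s a m i)
    ≡⟨ cong (_+_ (binomialTransform s (a ∘ suc) m)) (sumBelow-*ˡ (suc m) s (binomialTerm s a m)) ⟩
  binomialTransform s (a ∘ suc) m + s * binomialTransform s a m ∎
  where
  pull-s : ∀ s n p x → n * (s * p * x) ≡ s * (n * (p * x))
  pull-s = solve-∀

neg-^ : ∀ t i → (- t) ^ i ≡ (- + 1) ^ i * t ^ i
neg-^ t zero    = refl
neg-^ t (suc i) = trans (cong (- t *_) (neg-^ t i)) (regroup t ((- + 1) ^ i) (t ^ i))
  where
  regroup : ∀ t p q → - t * (p * q) ≡ - + 1 * p * (t * q)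
  regroup = solve-∀

binomialTransform-neg : ∀ t (a : ℕ → ℤ) m →
  binomialTransform (- t) a m ≡ sumℤ m (λ i → (- + 1) ^ i * t ^ i * + (m C i) * a (m ∸ i))
binomialTransform-neg t a m = trans
  (sumBelow-cong (suc m) (λ i → trans (cong (λ p → + (m C i) * (p * a (m ∸ i))) (neg-^ t i))
                                      (regroup (+ (m C i)) ((- + 1) ^ i) (t ^ i) (a (m ∸ i)))))
  (sym (sumℤ≡sumBelow m (λ i → (- + 1) ^ i * t ^ i * + (m C i) * a (m ∸ i))))
  where
  regroup : ∀ n p q x → n * (p * q * x) ≡ p * q * n * x
  regroup = solve-∀

sumList : List ℤ → ℤ
sumList = foldr _+_ (+ 0)

sumList-++ : ∀ xs ys → sumList (xs ++ ys) ≡ sumList xs + sumList ys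
sumList-++ []       ys = sym (+-identityˡ _)
sumList-++ (x ∷ xs) ys = trans (cong (_+_ x) (sumList-++ xs ys)) (sym (+-assoc x _ _))

module _ {A : Set} where

  sumList-+ : ∀ (f g : A → ℤ) xs →
    sumList (map (λ x → f x + g x) xs) ≡ sumList (map f xs) + sumList (map g xs)
  sumList-+ f g []       = refl
  sumList-+ f g (x ∷ xs) =
    trans (cong (_+_ (f x + g x)) (sumList-+ f g xs)) (interchange (f x) (g x) _ _)
    where
    interchange : ∀ a b c d → a + b + (c + d) ≡ a + c + (b + d)
    interchange = solve-∀

  sumList-*ˡ : ∀ c (f : A → ℤ) xs → sumList (map (λ x → c * f x) xs) ≡ c * sumList (map f xs)
  sumList-*ˡ c f []       = sym (*-zeroʳ c)
  sumList-*ˡ c f (x ∷ xs) = trans (cong (_+_ (c * f x)) (sumList-*ˡ c f xs)) (sym (*-distribˡ-+ c _ _))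

sumList-concatMap : ∀ {A B : Set} (f : B → ℤ) (g : A → List B) xs →
  sumList (map f (concatMap g xs)) ≡ sumList (map (λ x → sumList (map f (g x))) xs)
sumList-concatMap f g []       = refl
sumList-concatMap f g (x ∷ xs) = begin
  sumList (map f (g x ++ concatMap g xs))
    ≡⟨ cong sumList (map-++ f (g x) (concatMap g xs)) ⟩
  sumList (map f (g x) ++ map f (concatMap g xs))
    ≡⟨ sumList-++ (map f (g x)) _ ⟩
  sumList (map f (g x)) + sumList (map f (concatMap g xs))
    ≡⟨ cong (_+_ (sumList (map f (g x)))) (sumList-concatMap f g xs) ⟩
  sumList (map (λ x → sumList (map f (g x))) (x ∷ xs)) ∎

sumList-words-suc : ∀ {A : Set} (xs : List A) (f : List A → ℤ) m →
  sumList (map f (words xs (suc m))) ≡ sumList (map (λ w → sumList (map (λ x → f (x ∷ w)) xs)) (words xs m))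
sumList-words-suc xs f m = trans (sumList-concatMap f (λ w → map (_∷ w) xs) (words xs m))
  (cong sumList (map-cong (λ w → cong sumList (sym (map-∘ xs))) (words xs m)))

pos-sum-map : ∀ {A : Set} (f : A → ℕ) xs → + ℕ.sum (map f xs) ≡ sumList (map (+_ ∘ f) xs)
pos-sum-map f []       = refl
pos-sum-map f (x ∷ xs) = trans (pos-+ (f x) (ℕ.sum (map f xs))) (cong (_+_ (+ f x)) (pos-sum-map f xs))

pos-^ : ∀ m n → + (m ℕ.^ n) ≡ (+ m) ^ n
pos-^ m zero    = refl
pos-^ m (suc n) = trans (pos-* m (m ℕ.^ n)) (cong (+ m *_) (pos-^ m n))

module MarkedWords {A : Set} (letters : List A) where

  Word : Set
  Word = List (Maybe A)

  erase : Word → Word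
  erase []            = []
  erase (nothing ∷ w) = erase w
  erase (just a ∷ w)  = just a ∷ erase w

  cells : Word → ℕ
  cells []            = 0
  cells (nothing ∷ w) = suc (cells w)
  cells (just _ ∷ w)  = cells w

  plainWords markedWords : ℕ → List Word
  plainWords  = words (map just letters)
  markedWords = words (nothing ∷ map just letters)

  headSum : (Word → ℤ) → Word → ℤ
  headSum h u = sumList (map (λ a → h (just a ∷ u)) letters)

  plainSum : (Word → ℤ) → ℕ → ℤ
  plainSum h m = sumList (map h (plainWords m))

  markedSum : ℤ → (Word → ℤ) → ℕ → ℤ
  markedSum t h m = sumList (map (λ w → t ^ cells w * h (erase w)) (markedWords m))

  plainSum-suc : ∀ h m → plainSum h (suc m) ≡ plainSum (headSum h) m
  plainSum-suc h m = trans (sumList-words-suc (map just letters) h m)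
    (cong sumList (map-cong (λ u → cong sumList (sym (map-∘ letters))) (plainWords m)))

  markedSum-suc : ∀ t h m → markedSum t h (suc m) ≡ t * markedSum t h m + markedSum t (headSum h) m
  markedSum-suc t h m = begin
    markedSum t h (suc m)
      ≡⟨ sumList-words-suc (nothing ∷ map just letters) F m ⟩
    sumList (map (λ w → F (nothing ∷ w) + sumList (map (λ x → F (x ∷ w)) (map just letters))) (markedWords m))
      ≡⟨ cong sumList (map-cong split-head (markedWords m)) ⟩
    sumList (map (λ w → t * F w + t ^ cells w * headSum h (erase w)) (markedWords m))
      ≡⟨ sumList-+ (λ w → t * F w) _ (markedWords m) ⟩
    sumList (map (λ w → t * F w) (markedWords m)) + markedSum t (headSum h) m
      ≡⟨ cong (_+ markedSum t (headSum h) m) (sumList-*ˡ t F (markedWords m)) ⟩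
    t * markedSum t h m + markedSum t (headSum h) m ∎
    where
    F : Word → ℤ
    F w = t ^ cells w * h (erase w)
    split-head : ∀ w → F (nothing ∷ w) + sumList (map (λ x → F (x ∷ w)) (map just letters)) ≡
                       t * F w + t ^ cells w * headSum h (erase w)
    split-head w = cong₂ _+_ (*-assoc t (t ^ cells w) (h (erase w)))
      (trans (cong sumList (sym (map-∘ letters))) (sumList-*ˡ (t ^ cells w) _ letters))

  plainSum-inversion : ∀ t h m → plainSum h m ≡ binomialTransform (- t) (markedSum t h) m
  plainSum-inversion t h zero    = unit (h [])
    where
    unit : ∀ x → x + + 0 ≡ + 1 * (+ 1 * (+ 1 * x + + 0)) + + 0
    unit = solve-∀
  plainSum-inversion t h (suc m) = begin
    plainSum h (suc m)
      ≡⟨ plainSum-suc h m ⟩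
    plainSum (headSum h) m
      ≡⟨ plainSum-inversion t (headSum h) m ⟩
    binomialTransform (- t) (markedSum t (headSum h)) m
      ≡⟨ binomialTransform-cong (- t) m solve-for-headSum ⟩
    binomialTransform (- t) (λ j → markedSum t h (suc j) + - t * markedSum t h j) m
      ≡⟨ binomialTransform-linear (- t) (- t) (markedSum t h ∘ suc) (markedSum t h) m ⟩
    binomialTransform (- t) (markedSum t h ∘ suc) m + - t * binomialTransform (- t) (markedSum t h) m
      ≡⟨ sym (binomialTransform-suc (- t) (markedSum t h) m) ⟩
    binomialTransform (- t) (markedSum t h) (suc m) ∎
    where
    isolate : ∀ t x y → y ≡ t * x + y + - t * x
    isolate = solve-∀
    solve-for-headSum : ∀ j → markedSum t (headSum h) j ≡ markedSum t h (suc j) + - t * markedSum t h j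
    solve-for-headSum j = trans (isolate t (markedSum t h j) _)
      (cong (_+ - t * markedSum t h j) (sym (markedSum-suc t h j)))

allL-cong : ∀ {A : Set} {p q : A → Bool} → (∀ x → p x ≡ q x) → ∀ xs → allL p xs ≡ allL q xs
allL-cong p≗q []       = refl
allL-cong p≗q (x ∷ xs) = cong₂ _∧_ (p≗q x) (allL-cong p≗q xs)

pred<⇔≤ : ∀ ℓ c → (+ ℓ - + 1 < + c) ⇔ (ℓ ℕ.≤ c)
pred<⇔≤ zero    c = mk⇔ (λ _ → z≤n) (λ _ → -<+)
pred<⇔≤ (suc ℓ) c = mk⇔ drop‿+<+ +<+

if-scale : ∀ b x → + (if b then x else 0) ≡ + x * + (if b then 1 else 0)
if-scale true  x = sym (*-identityʳ (+ x))
if-scale false x = sym (*-zeroʳ (+ x))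

module _ (k : ℕ) where
  open MarkedWords (allFin k)

  rg-erase : ∀ c w → rg k c w ≡ rg k c (erase w)
  rg-erase c []            = refl
  rg-erase c (nothing ∷ w) = rg-erase c w
  rg-erase c (just j ∷ w)  = cong₂ (λ b b′ → if toℕ j ℕ.<ᵇ c then b else if toℕ j ℕ.≡ᵇ c then b′ else false)
                                   (rg-erase c w) (rg-erase (suc c) w)

  countM-just-erase : ∀ j w → countM (just j) w ≡ countM (just j) (erase w)
  countM-just-erase j []            = refl
  countM-just-erase j (nothing ∷ w) = countM-just-erase j w
  countM-just-erase j (just i ∷ w)  = cong (_ ℕ.+_) (countM-just-erase j w)

  countM-nothing : ∀ w → countM nothing w ≡ cells w
  countM-nothing []            = refl
  countM-nothing (nothing ∷ w) = cong suc (countM-nothing w)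
  countM-nothing (just _ ∷ w)  = countM-nothing w

  blocksAbove-pred : ∀ ℓ w → blocksAbove k (+ ℓ - + 1) w ≡ blocksAtLeast k ℓ (erase w)
  blocksAbove-pred ℓ w = allL-cong
    (λ j → trans (does-⇔ (pred<⇔≤ ℓ _) (_ <? _) (ℓ ≤? _)) (cong (ℓ ≤ᵇ_) (countM-just-erase j w)))
    (allFin k)

  isPartitionWord : ℕ → Word → Bool
  isPartitionWord ℓ u = rg k 0 u ∧ blocksAtLeast k ℓ u

  partitionIndicator : ℕ → Word → ℤ
  partitionIndicator ℓ u = + (if isPartitionWord ℓ u then 1 else 0)

  stirlingGE≡plainSum : ∀ n ℓ → + stirlingGE n k ℓ ≡ plainSum (partitionIndicator ℓ) n
  stirlingGE≡plainSum n ℓ = pos-sum-map _ (plainWords n)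

  stirlingGamma≡markedSum : ∀ ℓ γ m →
    + stirlingGamma m k (+ ℓ - + 1) γ ≡ markedSum (+ γ) (partitionIndicator ℓ) m
  stirlingGamma≡markedSum ℓ γ m =
    trans (pos-sum-map _ (markedWords m)) (cong sumList (map-cong erase-cells (markedWords m)))
    where
    erase-cells : ∀ w → + (if rg k 0 w ∧ blocksAbove k (+ ℓ - + 1) w then γ ℕ.^ countM nothing w else 0) ≡
                        (+ γ) ^ cells w * partitionIndicator ℓ (erase w)
    erase-cells w = begin
      + (if rg k 0 w ∧ blocksAbove k (+ ℓ - + 1) w then γ ℕ.^ countM nothing w else 0)
        ≡⟨ cong₂ (λ b c → + (if b then γ ℕ.^ c else 0))
                 (cong₂ _∧_ (rg-erase 0 w) (blocksAbove-pred ℓ w)) (countM-nothing w) ⟩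
      + (if isPartitionWord ℓ (erase w) then γ ℕ.^ cells w else 0)
        ≡⟨ if-scale (isPartitionWord ℓ (erase w)) (γ ℕ.^ cells w) ⟩
      + (γ ℕ.^ cells w) * partitionIndicator ℓ (erase w)
        ≡⟨ cong (_* partitionIndicator ℓ (erase w)) (pos-^ γ (cells w)) ⟩
      (+ γ) ^ cells w * partitionIndicator ℓ (erase w) ∎

mainTheorem2 : (n k ℓ γ : ℕ) →
    + stirlingGE n k ℓ ≡
      sumℤ n (λ i → ((- + 1) ^ i) * ((+ γ) ^ i) * (+ (n C i)) * (+ stirlingGamma (n ∸ i) k (+ ℓ - + 1) γ))
mainTheorem2 n k ℓ γ = begin
  + stirlingGE n k ℓ
    ≡⟨ stirlingGE≡plainSum k n ℓ ⟩
  plainSum (partitionIndicator k ℓ) n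
    ≡⟨ plainSum-inversion (+ γ) (partitionIndicator k ℓ) n ⟩
  binomialTransform (- + γ) (markedSum (+ γ) (partitionIndicator k ℓ)) n
    ≡⟨ binomialTransform-neg (+ γ) (markedSum (+ γ) (partitionIndicator k ℓ)) n ⟩
  sumℤ n (λ i → (- + 1) ^ i * (+ γ) ^ i * + (n C i) * markedSum (+ γ) (partitionIndicator k ℓ) (n ∸ i))
    ≡⟨ sumℤ-cong n (λ i → cong (_*_ ((- + 1) ^ i * (+ γ) ^ i * + (n C i))) (sym (stirlingGamma≡markedSum k ℓ γ (n ∸ i)))) ⟩
  sumℤ n (λ i → (- + 1) ^ i * (+ γ) ^ i * + (n C i) * + stirlingGamma (n ∸ i) k (+ ℓ - + 1) γ) ∎
  where open MarkedWords (allFin k)
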